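{- Let $G$ be a graph, $w$ a positive integer, $S\subseteq V(G)$, and let $(A',B')$ and $(P,Q)$ be separations of $G$ with $(P,Q)\leq (A',B')$. If $(A',B')$ is $(w,S)$-good and there are $|V(P)\cap V(Q)|$ pairwise vertex-disjoint $V(P)$--$V(B')$ paths in $G$, then $(P,Q)$ is $(w,S)$-good.
   Context: A separation of $G$ is a pair $(A,B)$ of subgraphs of $G$ with $A\cup B=G$ and $E(A\cap B)=\emptyset$; its order is $|V(A)\cap V(B)|$. Write $(A,B)\le(A',B')$ if $A\subseteq A'$ and $B\supseteq B'$. For $X,Y\subseteq V(G)$, an $X$--$Y$ path is either a one-vertex path whose vertex lies in $X\cap Y$, or a path with one end in $X$, the other in $Y$, and no internal vertex in $X\cup Y$. A path decomposition of a graph $H$ is a sequence of bags $(W_1,\dots,W_m)$, $m\ge1$, of subsets of $V(H)$ such that every edge of $H$ lies in some bag and for every vertex $v$ the set $\{i:v\in W_i\}$ is a non-empty interval; its width is $\max_i|W_i|-1$. For a graph $A$ and $S'\subseteq V(A)$, a path decomposition of $(A,S')$ is a path decomposition of some induced subgraph $H$ of $A$ with $S'\subseteq V(H)$ such that for every component $C$ of $A-V(H)$ some bag contains all neighbours of $V(C)$ in $A$. A separation $(A,B)$ of $G$ is $(w,S)$-good if it has order at most $w$ and $(A,S\cap V(A))$ has a path decomposition $(W_1,\dots,W_m)$ of width at most $2w-2$ with $V(A)\cap V(B)\subseteq W_m$. -}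

module Defs where

open import Data.Nat using (ℕ; zero; suc; _+_; _*_; _∸_; _≤_)
open import Data.Bool using (Bool; true; false)
open import Data.Fin using (Fin; fromℕ; inject₁) renaming (_≤_ to _≤ᶠ_; suc to fsuc)
open import Data.Fin.Subset using (Subset; _∈_; _∉_; _⊆_; _∩_; _∪_; ∣_∣; ⊤)
open import Data.Product using (Σ; ∃; _×_; _,_)
open import Data.Sum using (_⊎_)
open import Relation.Nullary using (¬_)
open import Relation.Binary.PropositionalEquality using (_≡_; _≢_)
open import Function.Definitions using (Injective)

record Graph (n : ℕ) : Set where
  field
    adj     : Fin n → Fin n → Bool
    adj-sym : ∀ u v → adj u v ≡ true → adj v u ≡ true
    adj-irr : ∀ u → adj u u ≡ false
open Graph public

Edge : ∀ {n} → Graph n → Fin n → Fin n → Set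
Edge G u v = adj G u v ≡ true

record Subgraph {n : ℕ} (G : Graph n) : Set where
  field
    V      : Subset n
    E      : Fin n → Fin n → Bool
    E-sym  : ∀ u v → E u v ≡ true → E v u ≡ true
    E-edge : ∀ u v → E u v ≡ true → Edge G u v
    E-ends : ∀ u v → E u v ≡ true → u ∈ V
open Subgraph public

EdgeOf : ∀ {n} {G : Graph n} → Subgraph G → Fin n → Fin n → Set
EdgeOf A u v = E A u v ≡ true

_⊑_ : ∀ {n} {G : Graph n} → Subgraph G → Subgraph G → Set
A ⊑ A' = (V A ⊆ V A') × (∀ u v → EdgeOf A u v → EdgeOf A' u v)

IsSeparation : ∀ {n} (G : Graph n) → Subgraph G → Subgraph G → Set
IsSeparation {n} G A B =
  (∀ (x : Fin n) → x ∈ V A ⊎ x ∈ V B)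
  × (∀ u v → Edge G u v → EdgeOf A u v ⊎ EdgeOf B u v)
  × (∀ u v → ¬ (EdgeOf A u v × EdgeOf B u v))

order : ∀ {n} {G : Graph n} → Subgraph G → Subgraph G → ℕ
order A B = ∣ V A ∩ V B ∣

SepLeq : ∀ {n} {G : Graph n} → Subgraph G → Subgraph G → Subgraph G → Subgraph G → Set
SepLeq A B A' B' = (A ⊑ A') × (B' ⊑ B)

record Path {n : ℕ} (G : Graph n) : Set where
  field
    len   : ℕ                       -- number of edges k
    vtx   : Fin (suc len) → Fin n
    inj   : Injective _≡_ _≡_ vtx
    steps : ∀ (i : Fin len) → Edge G (vtx (inject₁ i)) (vtx (fsuc i))
open Path public

OnPath : ∀ {n} {G : Graph n} → Fin n → Path G → Set
OnPath x P = ∃ λ i → vtx P i ≡ x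

firstV lastV : ∀ {n} {G : Graph n} → Path G → Fin n
firstV P = vtx P Data.Fin.zero
lastV P = vtx P (fromℕ (len P))

Internal : ∀ {n} {G : Graph n} → Path G → Fin n → Set
Internal P x = OnPath x P × x ≢ firstV P × x ≢ lastV P

IsXYPath : ∀ {n} {G : Graph n} → Subset n → Subset n → Path G → Set
IsXYPath X Y P with len P
... | zero  = firstV P ∈ X × firstV P ∈ Y
... | suc _ = ((firstV P ∈ X × lastV P ∈ Y) ⊎ (firstV P ∈ Y × lastV P ∈ X))
              × (∀ x → Internal P x → x ∉ X × x ∉ Y)

DisjointXYPaths : ∀ {n} (G : Graph n) → Subset n → Subset n → ℕ → Set
DisjointXYPaths G X Y m =
  Σ (Fin m → Path G) λ P →
    (∀ i → IsXYPath X Y (P i))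
    × (∀ i j → i ≢ j → ∀ x → OnPath x (P i) → ¬ OnPath x (P j))

data ConnOutside {n} {G : Graph n} (A : Subgraph G) (U : Subset n) : Fin n → Fin n → Set where
  here : ∀ {x} → x ∈ V A → x ∉ U → ConnOutside A U x x
  step : ∀ {x y z} → ConnOutside A U x y → EdgeOf A y z → z ∉ U → ConnOutside A U x z

-- Vertex set of the component of A - U containing x.
InComponent : ∀ {n} {G : Graph n} → Subgraph G → Subset n → Fin n → Fin n → Set
InComponent A U x y = ConnOutside A U x y

-- A path decomposition of the induced subgraph H = A[U] with bags
-- W 0, …, W m (m+1 ≥ 1 bags), of width at most k, with the property for
-- (A, S').
record PathDecomp {n : ℕ} {G : Graph n} (A : Subgraph G) (S' : Subset n) (k : ℕ) : Set where
  field
    U        : Subset n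
    U⊆A      : U ⊆ V A
    S'⊆U     : S' ⊆ U
    m        : ℕ                            -- number of bags is suc m
    W        : Fin (suc m) → Subset n
    W⊆U      : ∀ i → W i ⊆ U
    edges    : ∀ u v → u ∈ U → v ∈ U → EdgeOf A u v → ∃ λ i → u ∈ W i × v ∈ W i
    nonempty : ∀ v → v ∈ U → ∃ λ i → v ∈ W i
    interval : ∀ v (i j l : Fin (suc m)) → i ≤ᶠ j → j ≤ᶠ l → v ∈ W i → v ∈ W l → v ∈ W j
    width    : ∀ i → ∣ W i ∣ ∸ 1 ≤ k
    -- every component C of A - V(H) (the component of x) has all its
    -- neighbours in A inside some bag
    comps    : ∀ x → x ∈ V A → x ∉ U →
               ∃ λ i → ∀ c v → InComponent A U x c → EdgeOf A c v →
                       ¬ InComponent A U x v → v ∈ W i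

lastBag : ∀ {n} {G : Graph n} {A : Subgraph G} {S' : Subset n} {k : ℕ} →
          PathDecomp A S' k → Subset n
lastBag D = PathDecomp.W D (fromℕ (PathDecomp.m D))

Good : ∀ {n} {G : Graph n} → ℕ → Subset n → Subgraph G → Subgraph G → Set
Good {n} w S A B =
  order A B ≤ w
  × Σ (PathDecomp A (S ∩ V A) (2 * w ∸ 2)) λ D → (V A ∩ V B) ⊆ lastBag D

-- Contract each of the k = |V(P) ∩ V(Q)| disjoint V(P)–V(B') paths onto its end in V(P);
-- that end lies in V(P) ∩ V(Q), the ends are distinct, and so they are all of V(P) ∩ V(Q).
-- Every path meets the separator V(A') ∩ V(B'), which gives k ≤ |V(A') ∩ V(B')| ≤ w.
-- Contracting the bags of the decomposition of A' and keeping their vertices in P yields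
-- bags that are no larger, with V(P) ∩ V(Q) in the last one, over the vertex set
-- (V(H') ∩ V(P)) ∪ (V(P) ∩ V(Q)). The interval and component conditions survive because a
-- walk in G, such as one along a contracted path, cannot get from bag i to bag l without
-- meeting every bag in between: the separator of (A', B') lies in the last bag.

module Submission where

open import Defs
open import Data.Nat as ℕ using (ℕ; zero; suc; z≤n; s≤s) renaming (_≤_ to _≤ℕ_)
import Data.Nat.Properties as ℕP
open import Data.Fin as F using (Fin; fromℕ; inject₁; _≟_)
open import Data.Fin.Properties as FP using (any?; suc-injective; 0≢1+n; ≤fromℕ; ≤∧≢⇒<)
open import Data.Fin.Subset using (Subset; inside; outside; _∈_; _∉_; _⊆_; _∩_; _∪_; ∣_∣; ⊤; _-_)
open import Data.Fin.Subset.Properties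
  using (_∈?_; x∈p∩q⁺; x∈p∩q⁻; x∈p∪q⁺; x∈p∪q⁻; ∣⊤∣≡n; x∈p∧x≢y⇒x∈p-y; x∈p⇒∣p-x∣<∣p∣)
open import Data.Vec using (tabulate; _∷_; []; here; there)
open import Data.Vec.Properties using (lookup∘tabulate; []=⇒lookup; lookup⇒[]=)
open import Data.Product using (∃; _×_; _,_; proj₁; proj₂; swap)
import Data.Product as Σ
open import Data.Sum using (_⊎_; inj₁; inj₂; map₂)
open import Data.Empty using (⊥-elim)
open import Function using (_∘_)
open import Function.Definitions using (Injective)
open import Relation.Nullary using (¬_; Dec; yes; no; does)
open import Relation.Nullary.Decidable using (dec-true; _×-dec_; _⊎-dec_)
open import Relation.Unary using (Decidable)
open import Relation.Binary.PropositionalEquality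

module _ {n : ℕ} {P : Fin n → Set} (P? : Decidable P) where

  subsetOf : Subset n
  subsetOf = tabulate (does ∘ P?)

  ∈-subsetOf⁺ : ∀ {x} → P x → x ∈ subsetOf
  ∈-subsetOf⁺ {x} px = lookup⇒[]= x subsetOf (trans (lookup∘tabulate _ x) (dec-true (P? x) px))

  ∈-subsetOf⁻ : ∀ {x} → x ∈ subsetOf → P x
  ∈-subsetOf⁻ {x} x∈ with P? x | trans (sym (lookup∘tabulate (does ∘ P?) x)) ([]=⇒lookup x∈)
  ... | yes px | _ = px

relation-injective⇒∣∣≤ : ∀ {m n} (Z : Subset m) (Y : Subset n) (R : Fin m → Fin n → Set) →
  (∀ {z} → z ∈ Z → ∃ λ y → y ∈ Y × R z y) →
  (∀ {z z' y} → z ∈ Z → z' ∈ Z → R z y → R z' y → z ≡ z') →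
  ∣ Z ∣ ≤ℕ ∣ Y ∣
relation-injective⇒∣∣≤ [] Y R total injective = z≤n
relation-injective⇒∣∣≤ (outside ∷ Z) Y R total injective =
  relation-injective⇒∣∣≤ Z Y (R ∘ F.suc) (total ∘ there)
    (λ z∈Z z'∈Z r r' → suc-injective (injective (there z∈Z) (there z'∈Z) r r'))
relation-injective⇒∣∣≤ (inside ∷ Z) Y R total injective with total here
... | y₀ , y₀∈Y , r₀ = ℕP.≤-trans (s≤s rest) (x∈p⇒∣p-x∣<∣p∣ y₀∈Y)
  where
  total' : ∀ {z} → z ∈ Z → ∃ λ y → y ∈ Y - y₀ × R (F.suc z) y
  total' z∈Z with total (there z∈Z)
  ... | y , y∈Y , r =
    y , x∈p∧x≢y⇒x∈p-y y∈Y (λ { refl → 0≢1+n (injective here (there z∈Z) r₀ r) }) , r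
  rest : ∣ Z ∣ ≤ℕ ∣ Y - y₀ ∣
  rest = relation-injective⇒∣∣≤ Z (Y - y₀) (R ∘ F.suc) total'
    (λ z∈Z z'∈Z r r' → suc-injective (injective (there z∈Z) (there z'∈Z) r r'))

injective⇒≤∣∣ : ∀ {k n} (f : Fin k → Fin n) (Y : Subset n) →
  (∀ j → f j ∈ Y) → Injective _≡_ _≡_ f → k ≤ℕ ∣ Y ∣
injective⇒≤∣∣ {k} f Y f∈Y f-inj = subst (_≤ℕ ∣ Y ∣) (∣⊤∣≡n k)
  (relation-injective⇒∣∣≤ ⊤ Y (λ j y → f j ≡ y) (λ {j} _ → f j , f∈Y j , refl)
    (λ _ _ r r' → f-inj (trans r (sym r'))))

infixr 5 _∷⟨_⟩_

data Walk {n : ℕ} (G : Graph n) (R : Fin n → Set) : Fin n → Fin n → Set where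
  [_]    : ∀ {x} → R x → Walk G R x x
  _∷⟨_⟩_ : ∀ {x y z} → R x → Edge G x y → Walk G R y z → Walk G R x z

module _ {n : ℕ} {G : Graph n} where

  module _ {R : Fin n → Set} where

    infixr 5 _++_

    head : ∀ {x y} → Walk G R x y → R x
    head [ r ] = r
    head (r ∷⟨ _ ⟩ _) = r

    _∷ʳ⟨_⟩_ : ∀ {x y z} → Walk G R x y → Edge G y z → R z → Walk G R x z
    [ r ] ∷ʳ⟨ e ⟩ r' = r ∷⟨ e ⟩ [ r' ]
    (r ∷⟨ e ⟩ w) ∷ʳ⟨ e' ⟩ r' = r ∷⟨ e ⟩ (w ∷ʳ⟨ e' ⟩ r')

    reverse : ∀ {x y} → Walk G R x y → Walk G R y x
    reverse [ r ] = [ r ]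
    reverse (r ∷⟨ e ⟩ w) = reverse w ∷ʳ⟨ adj-sym G _ _ e ⟩ r

    _++_ : ∀ {x y z} → Walk G R x y → Walk G R y z → Walk G R x z
    [ _ ] ++ w' = w'
    (r ∷⟨ e ⟩ w) ++ w' = r ∷⟨ e ⟩ (w ++ w')

  map : ∀ {R R' : Fin n → Set} → (∀ {v} → R v → R' v) → ∀ {x y} → Walk G R x y → Walk G R' x y
  map f [ r ] = [ f r ]
  map f (r ∷⟨ e ⟩ w) = f r ∷⟨ e ⟩ map f w

  walk-from-first : ∀ L (f : Fin (suc L) → Fin n) →
    (∀ i → Edge G (f (inject₁ i)) (f (F.suc i))) →
    ∀ i → Walk G (λ v → ∃ λ t → f t ≡ v) (f F.zero) (f i)
  walk-from-first L f steps F.zero = [ F.zero , refl ]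
  walk-from-first (suc L) f steps (F.suc i) =
    (F.zero , refl) ∷⟨ steps F.zero ⟩
      map (λ (t , eq) → F.suc t , eq) (walk-from-first L (f ∘ F.suc) (steps ∘ F.suc) i)

  walk-along : (p : Path G) → ∀ {a b} → OnPath a p → OnPath b p → Walk G (λ v → OnPath v p) a b
  walk-along p (i , refl) (j , refl) = reverse (from i) ++ from j
    where
    from : ∀ i → Walk G (λ v → OnPath v p) (vtx p F.zero) (vtx p i)
    from = walk-from-first (len p) (vtx p) (steps p)

  module _ (H : Subgraph G) where

    EdgeOf⇒∈ˡ : ∀ {u v} → EdgeOf H u v → u ∈ V H
    EdgeOf⇒∈ˡ {u} {v} e = E-ends H u v e

    EdgeOf⇒∈ʳ : ∀ {u v} → EdgeOf H u v → v ∈ V H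
    EdgeOf⇒∈ʳ {u} {v} e = E-ends H v u (E-sym H u v e)

  module _ {A : Subgraph G} {U : Subset n} where

    ConnOutside-∉ : ∀ {x y} → ConnOutside A U x y → y ∉ U
    ConnOutside-∉ (here _ y∉U) = y∉U
    ConnOutside-∉ (step _ _ y∉U) = y∉U

    ConnOutside-∈ : ∀ {x y} → ConnOutside A U x y → y ∈ V A
    ConnOutside-∈ (here y∈A _) = y∈A
    ConnOutside-∈ (step _ e _) = EdgeOf⇒∈ʳ A e

    ConnOutside-trans : ∀ {x y z} → ConnOutside A U x y → ConnOutside A U y z → ConnOutside A U x z
    ConnOutside-trans c (here _ _) = c
    ConnOutside-trans c (step c' e z∉U) = step (ConnOutside-trans c c') e z∉U

  ConnOutside-mono : ∀ {A A' : Subgraph G} {U U' : Subset n} → A ⊑ A' →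
    (∀ {v} → v ∈ V A → v ∉ U → v ∉ U') →
    ∀ {x y} → ConnOutside A U x y → ConnOutside A' U' x y
  ConnOutside-mono (V⊆ , E⊆) stays-outside (here x∈A x∉U) = here (V⊆ x∈A) (stays-outside x∈A x∉U)
  ConnOutside-mono {A} (V⊆ , E⊆) stays-outside (step c e z∉U) =
    step (ConnOutside-mono (V⊆ , E⊆) stays-outside c) (E⊆ _ _ e) (stays-outside (EdgeOf⇒∈ʳ A e) z∉U)

  BoundaryIn : Subgraph G → Subset n → Fin n → Subset n → Set
  BoundaryIn A U x W = ∀ c v → InComponent A U x c → EdgeOf A c v → ¬ InComponent A U x v → v ∈ W

  BoundaryIn-adjacent : ∀ {A : Subgraph G} {U W y z} → y ∈ V A → y ∉ U → EdgeOf A y z → z ∉ U →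
    BoundaryIn A U y W → BoundaryIn A U z W
  BoundaryIn-adjacent {A} {U} {y = y} {z} y∈A y∉U e z∉U bnd c v cz e' ¬cv =
    bnd c v (ConnOutside-trans yz cz) e' (λ cv → ¬cv (ConnOutside-trans zy cv))
    where
    yz : ConnOutside A U y z
    yz = step (here y∈A y∉U) e z∉U
    zy : ConnOutside A U z y
    zy = step (here (EdgeOf⇒∈ʳ A e) z∉U) (E-sym A y z e) y∉U

  walk-meets-separator : ∀ {A B : Subgraph G} {R a b} → IsSeparation G A B →
    Walk G R a b → a ∈ V A → b ∈ V B → ∃ λ v → R v × v ∈ V A × v ∈ V B
  walk-meets-separator sep [ r ] a∈A b∈B = _ , r , a∈A , b∈B
  walk-meets-separator {A} {B} {a = a} sep (r ∷⟨ e ⟩ w) a∈A b∈B with a ∈? V B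
  ... | yes a∈B = a , r , a∈A , a∈B
  ... | no a∉B with proj₁ (proj₂ sep) _ _ e
  ...   | inj₁ e∈A = walk-meets-separator {A} {B} sep w (EdgeOf⇒∈ʳ A e∈A) b∈B
  ...   | inj₂ e∈B = ⊥-elim (a∉B (EdgeOf⇒∈ˡ B e∈B))

  neighbour-outside⇒∈Q : ∀ {P Q : Subgraph G} {s u} → IsSeparation G P Q →
    Edge G s u → u ∉ V P → s ∈ V Q
  neighbour-outside⇒∈Q {P} {Q} sep e u∉P with proj₁ (proj₂ sep) _ _ e
  ... | inj₁ e∈P = ⊥-elim (u∉P (EdgeOf⇒∈ʳ P e∈P))
  ... | inj₂ e∈Q = EdgeOf⇒∈ˡ Q e∈Q

module BagWalks {n : ℕ} {G : Graph n} {A B : Subgraph G} (sep : IsSeparation G A B)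
  {S' : Subset n} {k : ℕ} (D : PathDecomp A S' k) (A∩B⊆last : V A ∩ V B ⊆ lastBag D) where

  open PathDecomp D

  split : ∀ {u v} → Edge G u v → EdgeOf A u v ⊎ EdgeOf B u v
  split = proj₁ (proj₂ sep) _ _

  separator⊆U : ∀ {v} → v ∈ V A → v ∈ V B → v ∈ U
  separator⊆U v∈A v∈B = W⊆U (fromℕ m) (A∩B⊆last (x∈p∩q⁺ (v∈A , v∈B)))

  walk-leaves-component-through : ∀ {R a s b X} → BoundaryIn A U a X →
    ConnOutside A U a s → Walk G R s b → b ∈ U → ∃ λ u → R u × u ∈ X
  walk-leaves-component-through bnd cs [ _ ] b∈U = ⊥-elim (ConnOutside-∉ cs b∈U)
  walk-leaves-component-through bnd cs (_∷⟨_⟩_ {y = y} _ e w) b∈U with split e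
  ... | inj₂ e∈B = ⊥-elim (ConnOutside-∉ cs (separator⊆U (ConnOutside-∈ cs) (EdgeOf⇒∈ˡ B e∈B)))
  ... | inj₁ e∈A with y ∈? U
  ...   | yes y∈U = y , head w , bnd _ y cs e∈A (λ cy → ConnOutside-∉ cy y∈U)
  ...   | no y∉U = walk-leaves-component-through bnd (step cs e∈A y∉U) w b∈U

  -- Everything to the left of bag j: a walk can only leave it from a vertex of bag j.
  LeftOf : Fin (suc m) → Fin n → Set
  LeftOf j v = ∃ λ c → c F.< j × (v ∈ W c ⊎ (v ∈ V A × v ∉ U × BoundaryIn A U v (W c)))

  in-bag-or-before : ∀ {y c d} j → c F.< j → y ∈ W c → y ∈ W d → y ∈ W j ⊎ d F.< j
  in-bag-or-before {y} {c} {d} j c<j y∈c y∈d with d F.<? j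
  ... | yes d<j = inj₂ d<j
  ... | no d≮j = inj₁ (interval y c j d (ℕP.<⇒≤ c<j) (ℕP.≮⇒≥ d≮j) y∈c y∈d)

  left-step-from-bag : ∀ {j c y z} → c F.< j → y ∈ W c → Edge G y z → y ∈ W j ⊎ LeftOf j z
  left-step-from-bag {j} {c} {y} {z} c<j y∈c e with split e
  ... | inj₂ e∈B = inj₁ (interval y c j (fromℕ m) (ℕP.<⇒≤ c<j) (≤fromℕ j) y∈c
                     (A∩B⊆last (x∈p∩q⁺ (U⊆A (W⊆U c y∈c) , EdgeOf⇒∈ˡ B e∈B))))
  ... | inj₁ e∈A with z ∈? U
  ...   | yes z∈U with edges y z (W⊆U c y∈c) z∈U e∈A
  ...     | d , y∈d , z∈d = map₂ (λ d<j → d , d<j , inj₁ z∈d) (in-bag-or-before j c<j y∈c y∈d)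
  left-step-from-bag {j} {c} {y} {z} c<j y∈c e | inj₁ e∈A | no z∉U
    with comps z (EdgeOf⇒∈ʳ A e∈A) z∉U
  ... | d , bnd = map₂ (λ d<j → d , d<j , inj₂ (EdgeOf⇒∈ʳ A e∈A , z∉U , bnd))
                    (in-bag-or-before j c<j y∈c y∈d)
    where
    y∈d : y ∈ W d
    y∈d = bnd z y (here (EdgeOf⇒∈ʳ A e∈A) z∉U) (E-sym A y z e∈A)
              (λ z~y → ConnOutside-∉ z~y (W⊆U c y∈c))

  left-step-from-component : ∀ {X y z} → y ∈ V A → y ∉ U → BoundaryIn A U y X → Edge G y z →
    z ∈ X ⊎ (z ∈ V A × z ∉ U × BoundaryIn A U z X)
  left-step-from-component {z = z} y∈A y∉U bnd e with split e
  ... | inj₂ e∈B = ⊥-elim (y∉U (separator⊆U y∈A (EdgeOf⇒∈ˡ B e∈B)))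
  ... | inj₁ e∈A with z ∈? U
  ...   | yes z∈U = inj₁ (bnd _ z (here y∈A y∉U) e∈A (λ cz → ConnOutside-∉ cz z∈U))
  ...   | no z∉U = inj₂ (EdgeOf⇒∈ʳ A e∈A , z∉U , BoundaryIn-adjacent y∈A y∉U e∈A z∉U bnd)

  left-step : ∀ {j y z} → LeftOf j y → Edge G y z → y ∈ W j ⊎ LeftOf j z
  left-step (c , c<j , inj₁ y∈c) e = left-step-from-bag c<j y∈c e
  left-step (c , c<j , inj₂ (y∈A , y∉U , bnd)) e =
    inj₂ (c , c<j , left-step-from-component y∈A y∉U bnd e)

  walk-from-left-meets : ∀ {R j l a b} → j F.≤ l → LeftOf j a → Walk G R a b → b ∈ W l →
    ∃ λ u → R u × u ∈ W j
  walk-from-left-meets {j = j} {l} j≤l (c , c<j , inj₁ b∈c) [ r ] b∈l =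
    _ , r , interval _ c j l (ℕP.<⇒≤ c<j) j≤l b∈c b∈l
  walk-from-left-meets {l = l} _ (_ , _ , inj₂ (_ , b∉U , _)) [ _ ] b∈l = ⊥-elim (b∉U (W⊆U l b∈l))
  walk-from-left-meets j≤l left (r ∷⟨ e ⟩ w) b∈l with left-step left e
  ... | inj₁ a∈j = _ , r , a∈j
  ... | inj₂ left' = walk-from-left-meets j≤l left' w b∈l

  walk-meets-bag-between : ∀ {R a b i j l} → i F.≤ j → j F.≤ l → a ∈ W i → b ∈ W l →
    Walk G R a b → ∃ λ u → R u × u ∈ W j
  walk-meets-bag-between {i = i} {j} i≤j j≤l a∈i b∈l w with i ≟ j
  ... | yes refl = _ , head w , a∈i
  ... | no i≢j = walk-from-left-meets j≤l (i , ≤∧≢⇒< i≤j i≢j , inj₁ a∈i) w b∈l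

module Linkage {n : ℕ} {G : Graph n} {A' B' P Q : Subgraph G}
  (sepA : IsSeparation G A' B') (sepP : IsSeparation G P Q) (le : SepLeq P Q A' B')
  (paths : Fin (order P Q) → Path G)
  (linking : ∀ j → IsXYPath (V P) (V B') (paths j))
  (disjoint : ∀ i j → i ≢ j → ∀ x → OnPath x (paths i) → ¬ OnPath x (paths j)) where

  X : Subset n
  X = V P ∩ V Q

  P⊆A' : V P ⊆ V A'
  P⊆A' = proj₁ (proj₁ le)

  B'⊆Q : V B' ⊆ V Q
  B'⊆Q = proj₁ (proj₂ le)

  -- The part of p that is contracted onto its root.
  record Branch (p : Path G) : Set₁ where
    field
      root     : Fin n
      root∈P   : root ∈ V P
      root∈Q   : root ∈ V Q
      Mem      : Fin n → Set
      mem?     : Decidable Mem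
      root-mem : Mem root
      mem⇒on   : ∀ {v} → Mem v → OnPath v p
      mem⇒∉P   : ∀ {v} → Mem v → v ≢ root → v ∉ V P
      exit     : Fin n
      exit-mem : Mem exit
      exit∈A'  : exit ∈ V A'
      exit∈B'  : exit ∈ V B'
      to-root  : ∀ {v} → Mem v → Walk G Mem v root

  vertex-branch : (p : Path G) → ∀ {s} → OnPath s p → s ∈ V P → s ∈ V B' → Branch p
  vertex-branch p {s} s-on s∈P s∈B' = record
    { root = s ; root∈P = s∈P ; root∈Q = B'⊆Q s∈B'
    ; Mem = _≡ s ; mem? = _≟ s ; root-mem = refl
    ; mem⇒on = λ { refl → s-on } ; mem⇒∉P = λ { refl s≢s → ⊥-elim (s≢s refl) }
    ; exit = s ; exit-mem = refl ; exit∈A' = P⊆A' s∈P ; exit∈B' = s∈B'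
    ; to-root = λ { refl → [ refl ] } }

  path-branch : (p : Path G) → ∀ {s t u} → OnPath s p → OnPath t p → s ∈ V P → t ∈ V B' →
    (∀ {v} → OnPath v p → v ≢ s → v ∉ V P) → OnPath u p → u ≢ s → Edge G s u → Branch p
  path-branch p {s} s-on t-on s∈P t∈B' only-s u-on u≢s e = record
    { root = s ; root∈P = s∈P ; root∈Q = neighbour-outside⇒∈Q {P = P} {Q} sepP e (only-s u-on u≢s)
    ; Mem = λ v → OnPath v p ; mem? = λ v → any? (λ i → vtx p i ≟ v) ; root-mem = s-on
    ; mem⇒on = λ on → on ; mem⇒∉P = only-s
    ; exit = proj₁ crossing ; exit-mem = proj₁ (proj₂ crossing)
    ; exit∈A' = proj₁ (proj₂ (proj₂ crossing)) ; exit∈B' = proj₂ (proj₂ (proj₂ crossing))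
    ; to-root = λ on → walk-along p on s-on }
    where
    crossing : ∃ λ v → OnPath v p × v ∈ V A' × v ∈ V B'
    crossing = walk-meets-separator {A = A'} {B'} sepA (walk-along p s-on t-on) (P⊆A' s∈P) t∈B'

  -- If the end of p in V(B') also lies in V(P), that end alone is the branch: the rest of p
  -- need not avoid V(P).
  branch : (p : Path G) → IsXYPath (V P) (V B') p → Branch p
  branch p@(record { len = zero ; vtx = f }) (f₀∈P , f₀∈B') =
    vertex-branch p (F.zero , refl) f₀∈P f₀∈B'
  branch p@(record { len = suc L ; vtx = f ; inj = f-inj ; steps = st })
         (inj₁ (f₀∈P , fₗ∈B') , internal)
    with f (F.suc (fromℕ L)) ∈? V P
  ... | yes fₗ∈P = vertex-branch p (F.suc (fromℕ L) , refl) fₗ∈P fₗ∈B'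
  ... | no fₗ∉P = path-branch p (F.zero , refl) (F.suc (fromℕ L) , refl) f₀∈P fₗ∈B' only-f₀
                    (F.suc F.zero , refl) (λ eq → 0≢1+n (f-inj (sym eq))) (st F.zero)
    where
    only-f₀ : ∀ {v} → OnPath v p → v ≢ f F.zero → v ∉ V P
    only-f₀ {v} on v≢f₀ with v ≟ f (F.suc (fromℕ L))
    ... | yes refl = fₗ∉P
    ... | no v≢fₗ = proj₁ (internal v (on , v≢f₀ , v≢fₗ))
  branch p@(record { len = suc L ; vtx = f ; inj = f-inj ; steps = st })
         (inj₂ (f₀∈B' , fₗ∈P) , internal)
    with f F.zero ∈? V P
  ... | yes f₀∈P = vertex-branch p (F.zero , refl) f₀∈P f₀∈B'
  ... | no f₀∉P = path-branch p (F.suc (fromℕ L) , refl) (F.zero , refl) fₗ∈P f₀∈B' only-fₗ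
                    (inject₁ (fromℕ L) , refl) (λ eq → FP.fromℕ≢inject₁ (sym (f-inj eq)))
                    (adj-sym G _ _ (st (fromℕ L)))
    where
    only-fₗ : ∀ {v} → OnPath v p → v ≢ f (F.suc (fromℕ L)) → v ∉ V P
    only-fₗ {v} on v≢fₗ with v ≟ f F.zero
    ... | yes refl = f₀∉P
    ... | no v≢f₀ = proj₁ (internal v (on , v≢f₀ , v≢fₗ))

  module Branches (j : Fin (order P Q)) = Branch (branch (paths j) (linking j))
  open Branches

  Mem-unique : ∀ {i j v} → Mem i v → Mem j v → i ≡ j
  Mem-unique {i} {j} {v} v∈i v∈j with i ≟ j
  ... | yes i≡j = i≡j
  ... | no i≢j = ⊥-elim (disjoint i j i≢j v (mem⇒on i v∈i) (mem⇒on j v∈j))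

  root-injective : Injective _≡_ _≡_ root
  root-injective {i} {j} eq = Mem-unique (root-mem i) (subst (Mem j) (sym eq) (root-mem j))

  exit-injective : Injective _≡_ _≡_ exit
  exit-injective {i} {j} eq = Mem-unique (exit-mem i) (subst (Mem j) (sym eq) (exit-mem j))

  root∈X : ∀ j → root j ∈ X
  root∈X j = x∈p∩q⁺ (root∈P j , root∈Q j)

  order≤separator : order P Q ≤ℕ order A' B'
  order≤separator =
    injective⇒≤∣∣ exit (V A' ∩ V B') (λ j → x∈p∩q⁺ (exit∈A' j , exit∈B' j)) exit-injective

  root-surjective : ∀ {x} → x ∈ X → ∃ λ j → root j ≡ x
  root-surjective {x} x∈X with any? (λ j → root j ≟ x)
  ... | yes found = found
  ... | no ¬found = ⊥-elim (ℕP.n≮n _ (ℕP.≤-<-trans roots≤∣X-x∣ (x∈p⇒∣p-x∣<∣p∣ x∈X)))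
    where
    roots≤∣X-x∣ : order P Q ≤ℕ ∣ X - x ∣
    roots≤∣X-x∣ = injective⇒≤∣∣ root (X - x)
      (λ j → x∈p∧x≢y⇒x∈p-y (root∈X j) (λ eq → ¬found (j , eq))) root-injective

  ContractsTo : Fin n → Fin n → Set
  ContractsTo v y = v ≡ y ⊎ ∃ λ j → Mem j v × root j ≡ y

  contractsTo? : ∀ v y → Dec (ContractsTo v y)
  contractsTo? v y = (v ≟ y) ⊎-dec any? (λ j → mem? j v ×-dec (root j ≟ y))

  member∈P⇒root : ∀ {j v} → Mem j v → v ∈ V P → v ≡ root j
  member∈P⇒root {j} {v} v∈j v∈P with v ≟ root j
  ... | yes v≡root = v≡root
  ... | no v≢root = ⊥-elim (mem⇒∉P j v∈j v≢root v∈P)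

  contractsTo-functional : ∀ {v y y'} → y ∈ V P → y' ∈ V P →
    ContractsTo v y → ContractsTo v y' → y ≡ y'
  contractsTo-functional _ _ (inj₁ refl) (inj₁ refl) = refl
  contractsTo-functional y∈P _ (inj₁ refl) (inj₂ (_ , v∈j , refl)) = member∈P⇒root v∈j y∈P
  contractsTo-functional _ y'∈P (inj₂ (_ , v∈j , refl)) (inj₁ refl) = sym (member∈P⇒root v∈j y'∈P)
  contractsTo-functional _ _ (inj₂ (_ , v∈i , refl)) (inj₂ (_ , v∈j , refl)) =
    cong root (Mem-unique v∈i v∈j)

  contractsTo-walk : ∀ {v y} → ContractsTo v y → Walk G (λ u → ContractsTo u y) v y
  contractsTo-walk (inj₁ refl) = [ inj₁ refl ]
  contractsTo-walk (inj₂ (j , v∈j , refl)) = map (λ u∈j → inj₂ (j , u∈j , refl)) (to-root j v∈j)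

  module Restriction {S : Subset n} {k : ℕ} (D : PathDecomp A' (S ∩ V A') k)
    (A'∩B'⊆last : V A' ∩ V B' ⊆ lastBag D) where

    open PathDecomp D
    open BagWalks {A = A'} {B'} sepA D A'∩B'⊆last

    P⊑A' : P ⊑ A'
    P⊑A' = proj₁ le

    Uᴾ : Subset n
    Uᴾ = (U ∩ V P) ∪ X

    ∈Uᴾ⁺ : ∀ {v} → v ∈ U → v ∈ V P → v ∈ Uᴾ
    ∈Uᴾ⁺ v∈U v∈P = x∈p∪q⁺ (inj₁ (x∈p∩q⁺ (v∈U , v∈P)))

    Uᴾ⊆P : Uᴾ ⊆ V P
    Uᴾ⊆P {v} v∈Uᴾ with x∈p∪q⁻ (U ∩ V P) X v∈Uᴾ
    ... | inj₁ v∈U∩P = proj₂ (x∈p∩q⁻ U (V P) v∈U∩P)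
    ... | inj₂ v∈X = proj₁ (x∈p∩q⁻ (V P) (V Q) v∈X)

    ∈Uᴾ∖U⇒∈X : ∀ {v} → v ∈ Uᴾ → v ∉ U → v ∈ X
    ∈Uᴾ∖U⇒∈X {v} v∈Uᴾ v∉U with x∈p∪q⁻ (U ∩ V P) X v∈Uᴾ
    ... | inj₁ v∈U∩P = ⊥-elim (v∉U (proj₁ (x∈p∩q⁻ U (V P) v∈U∩P)))
    ... | inj₂ v∈X = v∈X

    InBag : Fin (suc m) → Fin n → Set
    InBag i y = y ∈ V P × ∃ λ v → v ∈ W i × ContractsTo v y

    inBag? : ∀ i → Decidable (InBag i)
    inBag? i y = (y ∈? V P) ×-dec any? (λ v → (v ∈? W i) ×-dec contractsTo? v y)

    Wᴾ : Fin (suc m) → Subset n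
    Wᴾ i = subsetOf (inBag? i)

    ∈Wᴾ⁺ : ∀ {i v y} → y ∈ V P → ContractsTo v y → v ∈ W i → y ∈ Wᴾ i
    ∈Wᴾ⁺ {i} y∈P v↦y v∈i = ∈-subsetOf⁺ (inBag? i) (y∈P , _ , v∈i , v↦y)

    ∈Wᴾ⁻ : ∀ {i y} → y ∈ Wᴾ i → InBag i y
    ∈Wᴾ⁻ {i} = ∈-subsetOf⁻ (inBag? i)

    X⊆lastᴾ : X ⊆ Wᴾ (fromℕ m)
    X⊆lastᴾ x∈X with root-surjective x∈X
    ... | j , refl = ∈Wᴾ⁺ (root∈P j) (inj₂ (j , exit-mem j , refl))
                       (A'∩B'⊆last (x∈p∩q⁺ (exit∈A' j , exit∈B' j)))

    X∩component⊆boundary-bag : ∀ {a c x} → x ∈ X → BoundaryIn A' U a (W c) →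
      ConnOutside A' U a x → x ∈ Wᴾ c
    X∩component⊆boundary-bag x∈X bnd a~x with root-surjective x∈X
    ... | j , refl with walk-leaves-component-through bnd a~x (reverse (to-root j (exit-mem j)))
                          (separator⊆U (exit∈A' j) (exit∈B' j))
    ...   | u , u∈j , u∈c = ∈Wᴾ⁺ (root∈P j) (inj₂ (j , u∈j , refl)) u∈c

    neighbour⊆boundary-bag : ∀ {a c c₀ v} → BoundaryIn A' U a (W c) → ConnOutside A' U a c₀ →
      EdgeOf P c₀ v → v ∈ Uᴾ → v ∈ Wᴾ c
    neighbour⊆boundary-bag {v = v} bnd a~c₀ e v∈Uᴾ with v ∈? U
    ... | yes v∈U = ∈Wᴾ⁺ (Uᴾ⊆P v∈Uᴾ) (inj₁ refl)
                      (bnd _ v a~c₀ (proj₂ P⊑A' _ _ e) (λ a~v → ConnOutside-∉ a~v v∈U))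
    ... | no v∉U =
      X∩component⊆boundary-bag (∈Uᴾ∖U⇒∈X v∈Uᴾ v∉U) bnd (step a~c₀ (proj₂ P⊑A' _ _ e) v∉U)

    Wᴾ⊆Uᴾ : ∀ i → Wᴾ i ⊆ Uᴾ
    Wᴾ⊆Uᴾ i y∈i with ∈Wᴾ⁻ y∈i
    ... | y∈P , v , v∈i , inj₁ refl = ∈Uᴾ⁺ (W⊆U i v∈i) y∈P
    ... | _ , _ , _ , inj₂ (j , _ , refl) = x∈p∪q⁺ (inj₂ (root∈X j))

    edgeᴾ-outside-U : ∀ {u v} → u ∈ Uᴾ → v ∈ Uᴾ → EdgeOf P u v → u ∉ U →
      ∃ λ i → u ∈ Wᴾ i × v ∈ Wᴾ i
    edgeᴾ-outside-U {u} u∈Uᴾ v∈Uᴾ e u∉U with comps u (P⊆A' (Uᴾ⊆P u∈Uᴾ)) u∉U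
    ... | c , bnd = c , X∩component⊆boundary-bag (∈Uᴾ∖U⇒∈X u∈Uᴾ u∉U) bnd u~u
                      , neighbour⊆boundary-bag bnd u~u e v∈Uᴾ
      where
      u~u : ConnOutside A' U u u
      u~u = here (P⊆A' (Uᴾ⊆P u∈Uᴾ)) u∉U

    edgesᴾ : ∀ u v → u ∈ Uᴾ → v ∈ Uᴾ → EdgeOf P u v → ∃ λ i → u ∈ Wᴾ i × v ∈ Wᴾ i
    edgesᴾ u v u∈Uᴾ v∈Uᴾ e with u ∈? U | v ∈? U
    ... | no u∉U | _ = edgeᴾ-outside-U u∈Uᴾ v∈Uᴾ e u∉U
    ... | yes _ | no v∉U = Σ.map₂ swap (edgeᴾ-outside-U v∈Uᴾ u∈Uᴾ (E-sym P u v e) v∉U)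
    ... | yes u∈U | yes v∈U =
      Σ.map₂ (Σ.map (∈Wᴾ⁺ (Uᴾ⊆P u∈Uᴾ) (inj₁ refl)) (∈Wᴾ⁺ (Uᴾ⊆P v∈Uᴾ) (inj₁ refl)))
             (edges u v u∈U v∈U (proj₂ P⊑A' u v e))

    nonemptyᴾ : ∀ v → v ∈ Uᴾ → ∃ λ i → v ∈ Wᴾ i
    nonemptyᴾ v v∈Uᴾ with v ∈? U
    ... | no v∉U = fromℕ m , X⊆lastᴾ (∈Uᴾ∖U⇒∈X v∈Uᴾ v∉U)
    ... | yes v∈U = Σ.map₂ (∈Wᴾ⁺ (Uᴾ⊆P v∈Uᴾ) (inj₁ refl)) (nonempty v v∈U)

    intervalᴾ : ∀ y (i j l : Fin (suc m)) → i F.≤ j → j F.≤ l → y ∈ Wᴾ i → y ∈ Wᴾ l → y ∈ Wᴾ j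
    intervalᴾ y i j l i≤j j≤l y∈i y∈l with ∈Wᴾ⁻ y∈i | ∈Wᴾ⁻ y∈l
    ... | y∈P , a , a∈i , a↦y | _ , b , b∈l , b↦y
      with walk-meets-bag-between i≤j j≤l a∈i b∈l
             (contractsTo-walk a↦y ++ reverse (contractsTo-walk b↦y))
    ...   | u , u↦y , u∈j = ∈Wᴾ⁺ y∈P u↦y u∈j

    ∣Wᴾ∣≤∣W∣ : ∀ i → ∣ Wᴾ i ∣ ≤ℕ ∣ W i ∣
    ∣Wᴾ∣≤∣W∣ i = relation-injective⇒∣∣≤ (Wᴾ i) (W i) (λ y v → ContractsTo v y) (proj₂ ∘ ∈Wᴾ⁻)
      (λ y∈i y'∈i → contractsTo-functional (proj₁ (∈Wᴾ⁻ y∈i)) (proj₁ (∈Wᴾ⁻ y'∈i)))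

    compsᴾ : ∀ x → x ∈ V P → x ∉ Uᴾ → ∃ λ i → BoundaryIn P Uᴾ x (Wᴾ i)
    compsᴾ x x∈P x∉Uᴾ with comps x (P⊆A' x∈P) (λ x∈U → x∉Uᴾ (∈Uᴾ⁺ x∈U x∈P))
    ... | c , bnd = c , boundary
      where
      boundary : BoundaryIn P Uᴾ x (Wᴾ c)
      boundary c₀ v x~c₀ e x≁v with v ∈? Uᴾ
      ... | no v∉Uᴾ = ⊥-elim (x≁v (step x~c₀ e v∉Uᴾ))
      ... | yes v∈Uᴾ = neighbour⊆boundary-bag bnd
                         (ConnOutside-mono P⊑A' (λ v∈P v∉Uᴾ v∈U → v∉Uᴾ (∈Uᴾ⁺ v∈U v∈P)) x~c₀) e v∈Uᴾ

    restricted : PathDecomp P (S ∩ V P) k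
    restricted = record
      { U = Uᴾ
      ; U⊆A = Uᴾ⊆P
      ; S'⊆U = λ s∈S∩P → let s∈S , s∈P = x∈p∩q⁻ S (V P) s∈S∩P in
                           ∈Uᴾ⁺ (S'⊆U (x∈p∩q⁺ (s∈S , P⊆A' s∈P))) s∈P
      ; m = m
      ; W = Wᴾ
      ; W⊆U = Wᴾ⊆Uᴾ
      ; edges = edgesᴾ
      ; nonempty = nonemptyᴾ
      ; interval = intervalᴾ
      ; width = λ i → ℕP.≤-trans (ℕP.∸-monoˡ-≤ 1 (∣Wᴾ∣≤∣W∣ i)) (width i)
      ; comps = compsᴾ
      }

lemma4p1 : ∀ {n} (G : Graph n) (w : ℕ) → w ℕ.≥ 1 → (S : Subset n) →
    (A' B' P Q : Subgraph G) →
    IsSeparation G A' B' → IsSeparation G P Q → SepLeq P Q A' B' →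
    Good w S A' B' →
    DisjointXYPaths G (V P) (V B') (order P Q) →
    Good w S P Q
lemma4p1 G w _ S A' B' P Q sepA sepP le (order≤w , D , A'∩B'⊆last) (paths , linking , disjoint) =
  ℕP.≤-trans order≤separator order≤w , restricted , X⊆lastᴾ
  where
  open Linkage {A' = A'} {B'} {P} {Q} sepA sepP le paths linking disjoint
  open Restriction D A'∩B'⊆last
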